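{- Let $D=(d_1,\ldots,d_n)$ be a forcibly bicyclic graphic sequence. If $D$ has a realization $G$ containing a generalized bowtie graph $B(3,s)$ as a subgraph, then $3\le s\le 5$.
   Context: All graphs are simple. A realization of a sequence $D=(d_1,\ldots,d_n)$ is a simple graph with vertices $v_1,\ldots,v_n$ with $\deg(v_i)=d_i$; $D$ is graphic if it has a realization. A graphic sequence is forcibly bicyclic if every realization of it is connected and has exactly $n+1$ edges. $C_k$ denotes the cycle on $k$ vertices. The generalized bowtie $B(r,s)$ is obtained from disjoint copies of $C_r$ and $C_s$ by identifying a vertex of $C_r$ with a vertex of $C_s$. -}

module Defs where

open import Data.Nat using (ℕ; zero; suc; _+_; _*_; _≤_; _<_; _<ᵇ_)
open import Data.Bool using (Bool; true; false; if_then_else_; _∧_)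
open import Data.Fin using (Fin; toℕ)
open import Data.List using (List; map; allFin)
open import Data.Nat.ListAction using (sum)
open import Data.Vec using (Vec; lookup)
open import Data.Product using (Σ; ∃; _×_; _,_)
open import Data.Sum using (_⊎_)
open import Relation.Binary.PropositionalEquality using (_≡_)
open import Function.Definitions using (Injective)

record Graph (n : ℕ) : Set where
  field
    adj    : Fin n → Fin n → Bool
    sym    : ∀ i j → adj i j ≡ adj j i
    irrefl : ∀ i → adj i i ≡ false
open Graph public

deg : ∀ {n} → Graph n → Fin n → ℕ
deg G i = sum (map (λ j → if adj G i j then 1 else 0) (allFin _))

edgeCount : ∀ {n} → Graph n → ℕ
edgeCount {n} G =
  sum (map (λ i → sum (map (λ j → if (toℕ i <ᵇ toℕ j) ∧ adj G i j then 1 else 0)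
                           (allFin n)))
           (allFin n))

Realizes : ∀ {n} → Graph n → Vec ℕ n → Set
Realizes G D = ∀ i → deg G i ≡ lookup D i

Graphic : ∀ {n} → Vec ℕ n → Set
Graphic {n} D = Σ (Graph n) λ G → Realizes G D

data Walk {n} (G : Graph n) : Fin n → Fin n → Set where
  here : ∀ {i} → Walk G i i
  step : ∀ {i j k} → adj G i j ≡ true → Walk G j k → Walk G i k

Connected : ∀ {n} → Graph n → Set
Connected G = ∀ i j → Walk G i j

ForciblyBicyclic : ∀ {n} → Vec ℕ n → Set
ForciblyBicyclic {n} D =
  Graphic D × (∀ (G : Graph n) → Realizes G D → Connected G × edgeCount G ≡ n + 1)

-- c : Fin k → Fin n traces a cycle C_k (k ≥ 3) as a subgraph of G:
-- c is injective and c(i) ~ c(i+1 mod k) for all i.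
IsCycle : ∀ {n} → Graph n → (k : ℕ) → (Fin k → Fin n) → Set
IsCycle G k c =
  3 ≤ k × Injective _≡_ _≡_ c ×
  (∀ (i j : Fin k) → (suc (toℕ i) ≡ toℕ j ⊎ (suc (toℕ i) ≡ k × toℕ j ≡ 0))
                   → adj G (c i) (c j) ≡ true)

-- G contains the generalized bowtie B(r,s) as a subgraph: a copy of C_r and a
-- copy of C_s in G whose vertex sets meet in exactly one vertex.
ContainsBowtie : ∀ {n} → Graph n → ℕ → ℕ → Set
ContainsBowtie {n} G r s =
  Σ (Fin r → Fin n) λ c₁ → Σ (Fin s → Fin n) λ c₂ →
    IsCycle G r c₁ × IsCycle G s c₂ ×
    Σ (Fin r) λ a → Σ (Fin s) λ b →
      c₁ a ≡ c₂ b × (∀ i j → c₁ i ≡ c₂ j → i ≡ a × j ≡ b)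

-- A forcibly bicyclic realization of D is connected and has n + 1 edges. Deleting an edge
-- that still lies on a cycle keeps a graph connected, and a connected graph has a spanning
-- tree with n - 1 edges, so no realization has three edges that can be deleted one after
-- the other without disconnecting it. Write the bowtie as a triangle t₀t₁t₂ and a cycle
-- u₀u₁…u₅…u_{s-1} with s ≥ 6. If the chord u₂u₄ or u₁u₅ is present, delete t₀t₁, that chord
-- and u₀u_{s-1}. Otherwise the 2-switch u₁u₂, u₅u₄ ↦ u₁u₅, u₂u₄ preserves all degrees, so it
-- gives another realization, and there t₀t₁, u₂u₄ and u₀u_{s-1} can be deleted.

module Submission where

open import Defs hiding (sym)
open import Algebra.Properties.CommutativeSemigroup using (interchange)
open import Data.Bool using (Bool; true; false; not; _∧_; _∨_; if_then_else_)
open import Data.Bool.Properties using (∨-identityʳ; ∨-zeroʳ; T-∧; T-≡)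
open import Data.Fin using (Fin; zero; suc; toℕ; inject₁; fromℕ)
open import Data.Fin.Patterns using (0F; 1F; 2F; 3F; 4F; 5F)
open import Data.Fin.Properties using (_≟_; toℕ-injective; toℕ-inject₁; toℕ-fromℕ)
open import Data.List using (List; []; _∷_; map; allFin; length; concatMap; filterᵇ)
open import Data.List.Properties
  using (map-cong; map-tabulate; length-map; length-++; length-removeAt′; length-tabulate)
open import Data.List.Membership.Propositional using (_∈_; _∉_; _─_; lose)
open import Data.List.Membership.Propositional.Properties
  using (∈-allFin; ∈-map⁺; ∈-filter⁺; ∈-concatMap⁺)
open import Data.List.Relation.Unary.All as All using (All; []; _∷_)
open import Data.List.Relation.Unary.All.Properties using (¬Any⇒All¬; ¬All⇒Any¬)
open import Data.List.Relation.Unary.AllPairs using (AllPairs; []; _∷_)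
open import Data.List.Relation.Unary.Any using (here; there; index; satisfied; any?)
open import Data.List.Relation.Unary.Unique.Propositional using (Unique)
open import Data.List.Relation.Unary.Unique.Propositional.Properties using (allFin⁺)
open import Data.Nat using (ℕ; zero; suc; _+_; _∸_; _<_; _≤_; _<ᵇ_; _≤?_; pred; z≤n; s≤s; z<s; s<s)
open import Data.Nat.ListAction using (sum)
open import Data.Nat.Properties
  using (+-comm; +-commutativeSemigroup; m+[n∸m]≡n; ≰⇒>; <⇒≤; <⇒≱; <⇒<ᵇ; ≤-refl; ≤-reflexive;
         ≤-trans; n≤1+n; <-cmp)
open import Data.Nat.Tactic.RingSolver using (solve-∀)
open import Data.Product using (Σ; ∃; ∃₂; _×_; _,_; proj₁; proj₂)
open import Data.Sum using (_⊎_; inj₁; inj₂)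
open import Data.Vec using (Vec)
open import Function using (_∘_; Equivalence; mk⇔)
open import Relation.Binary using (tri<; tri≈; tri>)
open import Relation.Binary.PropositionalEquality
open import Relation.Nullary using (¬_; Dec; yes; no; does; contradiction)
open import Relation.Nullary.Decidable
  using (_×-dec_; _⊎-dec_; T?; False; toWitnessFalse; dec-true; dec-false; does-⇔)

-- Sums over Fin n

ind : Bool → ℕ
ind b = if b then 1 else 0

∑ : ∀ {n} → (Fin n → ℕ) → ℕ
∑ f = sum (map f (allFin _))

∑-cong : ∀ {n} {f g : Fin n → ℕ} → (∀ i → f i ≡ g i) → ∑ f ≡ ∑ g
∑-cong f≗g = cong sum (map-cong f≗g (allFin _))

sum-map-+ : ∀ {A : Set} (f g : A → ℕ) (xs : List A) →
  sum (map (λ x → f x + g x) xs) ≡ sum (map f xs) + sum (map g xs)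
sum-map-+ f g [] = refl
sum-map-+ f g (x ∷ xs) =
  trans (cong (f x + g x +_) (sum-map-+ f g xs)) (interchange +-commutativeSemigroup (f x) (g x) _ _)

∑-distrib-+ : ∀ {n} (f g : Fin n → ℕ) → ∑ (λ i → f i + g i) ≡ ∑ f + ∑ g
∑-distrib-+ f g = sum-map-+ f g (allFin _)

∑-suc : ∀ {n} (f : Fin (suc n) → ℕ) → ∑ f ≡ f zero + ∑ (f ∘ suc)
∑-suc f = cong (λ xs → f zero + sum xs)
  (trans (map-tabulate suc f) (sym (map-tabulate (λ i → i) (f ∘ suc))))

∑-zero : ∀ n → ∑ {n} (λ _ → 0) ≡ 0
∑-zero zero = refl
∑-zero (suc n) = trans (∑-suc {n} (λ _ → 0)) (∑-zero n)

δ : ∀ {n} → Fin n → Fin n → ℕ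
δ i j = ind (does (i ≟ j))

∑-δ : ∀ {n} (q : Fin n) → ∑ (λ j → δ j q) ≡ 1
∑-δ {suc n} zero = trans (∑-suc {n} (λ j → δ j zero)) (cong suc (∑-zero n))
∑-δ (suc q)      = trans (∑-suc (λ j → δ j (suc q))) (∑-δ q)

ind-∧-not : ∀ a {S : Set} (s? : Dec S) → (S → a ≡ true) →
  ind a ≡ ind (a ∧ not (does s?)) + ind (does s?)
ind-∧-not true  (yes _) _ = refl
ind-∧-not true  (no _)  _ = refl
ind-∧-not false (yes s) h with () ← h s
ind-∧-not false (no _)  _ = refl

ind-∨ : ∀ a {S : Set} (s? : Dec S) → (S → a ≡ false) →
  ind (a ∨ does s?) ≡ ind a + ind (does s?)
ind-∨ true  (yes s) h with () ← h s
ind-∨ true  (no _)  _ = refl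
ind-∨ false (yes _) _ = refl
ind-∨ false (no _)  _ = refl

-- Unordered pairs

Same : ∀ {n} (x y p q : Fin n) → Set
Same x y p q = (x ≡ p × y ≡ q) ⊎ (x ≡ q × y ≡ p)

same? : ∀ {n} (x y p q : Fin n) → Dec (Same x y p q)
same? x y p q = (x ≟ p ×-dec y ≟ q) ⊎-dec (x ≟ q ×-dec y ≟ p)

distinct : ∀ {m} (i j p q : Fin m) → {False (same? i j p q)} → ¬ Same i j p q
distinct i j p q {ij≁pq} = toWitnessFalse ij≁pq

Same-swap : ∀ {n} {x y p q : Fin n} → Same x y p q → Same y x p q
Same-swap (inj₁ (x≡p , y≡q)) = inj₂ (y≡q , x≡p)
Same-swap (inj₂ (x≡q , y≡p)) = inj₁ (y≡p , x≡q)

Same-comm : ∀ {n} {x y p q : Fin n} → Same x y p q → Same p q x y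
Same-comm (inj₁ (x≡p , y≡q)) = inj₁ (sym x≡p , sym y≡q)
Same-comm (inj₂ (x≡q , y≡p)) = inj₂ (sym y≡p , sym x≡q)

Same-diag : ∀ {n} {x p q : Fin n} → Same x x p q → p ≡ q
Same-diag (inj₁ (x≡p , x≡q)) = trans (sym x≡p) x≡q
Same-diag (inj₂ (x≡q , x≡p)) = trans (sym x≡p) x≡q

does-same?-swap : ∀ {n} (x y p q : Fin n) → does (same? x y p q) ≡ does (same? y x p q)
does-same?-swap x y p q = does-⇔ (mk⇔ Same-swap Same-swap) (same? x y p q) (same? y x p q)

SameEdge : ∀ {n} → Fin n × Fin n → Fin n × Fin n → Set
SameEdge (x , y) (p , q) = Same x y p q

Same-injective : ∀ {m n} {f : Fin m → Fin n} → (∀ {a b} → f a ≡ f b → a ≡ b) →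
  ∀ {i j p q} → Same (f i) (f j) (f p) (f q) → Same i j p q
Same-injective f-inj (inj₁ (i≡p , j≡q)) = inj₁ (f-inj i≡p , f-inj j≡q)
Same-injective f-inj (inj₂ (i≡q , j≡p)) = inj₂ (f-inj i≡q , f-inj j≡p)

∑-same : ∀ {n} (i p q : Fin n) → p ≢ q →
  ∑ (λ j → ind (does (same? i j p q))) ≡ δ i p + δ i q
-- Abstracting over i ≟ p and i ≟ q also rewrites them inside the summand.
∑-same {n} i p q p≢q with i ≟ p | i ≟ q
... | yes refl | yes refl = contradiction refl p≢q
... | yes refl | no _     = trans (∑-cong (λ j → cong ind (∨-identityʳ (does (j ≟ q))))) (∑-δ q)
... | no _     | yes refl = ∑-δ p
... | no _     | no _     = ∑-zero n

-- Deleting, adding and switching edges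

adj-Same : ∀ {n} (G : Graph n) {x y p q : Fin n} → Same x y p q → adj G x y ≡ adj G p q
adj-Same G (inj₁ (refl , refl)) = refl
adj-Same G (inj₂ (refl , refl)) = Graph.sym G _ _

adj⇒≢ : ∀ {n} (G : Graph n) {p q : Fin n} → adj G p q ≡ true → p ≢ q
adj⇒≢ G {p} pq refl with () ← trans (sym pq) (irrefl G p)

deleteEdge : ∀ {n} → Graph n → Fin n → Fin n → Graph n
deleteEdge G p q = record
  { adj    = λ x y → adj G x y ∧ not (does (same? x y p q))
  ; sym    = λ x y → cong₂ (λ a s → a ∧ not s) (Graph.sym G x y) (does-same?-swap x y p q)
  ; irrefl = λ x → cong (_∧ not (does (same? x x p q))) (irrefl G x)
  }

addEdge : ∀ {n} (G : Graph n) (p q : Fin n) → p ≢ q → Graph n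
addEdge G p q p≢q = record
  { adj    = λ x y → adj G x y ∨ does (same? x y p q)
  ; sym    = λ x y → cong₂ _∨_ (Graph.sym G x y) (does-same?-swap x y p q)
  ; irrefl = λ x → cong₂ _∨_ (irrefl G x) (dec-false (same? x x p q) (p≢q ∘ Same-diag))
  }

module _ {n} (G : Graph n) {p q : Fin n} where

  deleteEdge-⊆ : ∀ {x y} → adj (deleteEdge G p q) x y ≡ true → adj G x y ≡ true
  deleteEdge-⊆ {x} {y} xy with adj G x y
  ... | true = refl

  deleteEdge-deleted : ∀ {x y} → adj (deleteEdge G p q) x y ≡ true → ¬ Same x y p q
  deleteEdge-deleted {x} {y} xy S with adj G x y
  ... | true with () ← trans (sym (cong not (dec-true (same? x y p q) S))) xy

  deleteEdge-keeps : ∀ {x y} → adj G x y ≡ true → ¬ Same x y p q → adj (deleteEdge G p q) x y ≡ true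
  deleteEdge-keeps {x} {y} xy ¬S rewrite xy | dec-false (same? x y p q) ¬S = refl

  addEdge-⊇ : ∀ {x y} (p≢q : p ≢ q) → adj G x y ≡ true → adj (addEdge G p q p≢q) x y ≡ true
  addEdge-⊇ p≢q xy rewrite xy = refl

  addEdge-adds : ∀ {x y} (p≢q : p ≢ q) → Same x y p q → adj (addEdge G p q p≢q) x y ≡ true
  addEdge-adds {x} {y} p≢q S rewrite dec-true (same? x y p q) S = ∨-zeroʳ (adj G x y)

  addEdge-absent : ∀ {x y} (p≢q : p ≢ q) → adj G x y ≡ false → ¬ Same x y p q →
    adj (addEdge G p q p≢q) x y ≡ false
  addEdge-absent {x} {y} p≢q xy ¬S rewrite xy | dec-false (same? x y p q) ¬S = refl

  deleteEdge-absent : ∀ {x y} → adj G x y ≡ false → adj (deleteEdge G p q) x y ≡ false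
  deleteEdge-absent xy rewrite xy = refl

  deg-deleteEdge : adj G p q ≡ true → ∀ i → deg G i ≡ deg (deleteEdge G p q) i + (δ i p + δ i q)
  deg-deleteEdge pq i = begin
    deg G i
      ≡⟨ ∑-cong (λ j → ind-∧-not (adj G i j) (same? i j p q) (λ S → trans (adj-Same G S) pq)) ⟩
    ∑ (λ j → ind (adj (deleteEdge G p q) i j) + ind (does (same? i j p q)))
      ≡⟨ ∑-distrib-+ (λ j → ind (adj (deleteEdge G p q) i j)) (λ j → ind (does (same? i j p q))) ⟩
    deg (deleteEdge G p q) i + ∑ (λ j → ind (does (same? i j p q)))
      ≡⟨ cong (deg (deleteEdge G p q) i +_) (∑-same i p q (adj⇒≢ G pq)) ⟩
    deg (deleteEdge G p q) i + (δ i p + δ i q) ∎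
    where open ≡-Reasoning

  deg-addEdge : (p≢q : p ≢ q) → adj G p q ≡ false →
    ∀ i → deg (addEdge G p q p≢q) i ≡ deg G i + (δ i p + δ i q)
  deg-addEdge p≢q pq i = begin
    deg (addEdge G p q p≢q) i
      ≡⟨ ∑-cong (λ j → ind-∨ (adj G i j) (same? i j p q) (λ S → trans (adj-Same G S) pq)) ⟩
    ∑ (λ j → ind (adj G i j) + ind (does (same? i j p q)))
      ≡⟨ ∑-distrib-+ (λ j → ind (adj G i j)) (λ j → ind (does (same? i j p q))) ⟩
    deg G i + ∑ (λ j → ind (does (same? i j p q)))
      ≡⟨ cong (deg G i +_) (∑-same i p q p≢q) ⟩
    deg G i + (δ i p + δ i q) ∎
    where open ≡-Reasoning

deleteEdges : ∀ {n} → Graph n → List (Fin n × Fin n) → Graph n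
deleteEdges G []             = G
deleteEdges G ((p , q) ∷ es) = deleteEdges (deleteEdge G p q) es

deleteEdges-⊆ : ∀ {n} (G : Graph n) es {x y} → adj (deleteEdges G es) x y ≡ true → adj G x y ≡ true
deleteEdges-⊆ G []             xy = xy
deleteEdges-⊆ G ((p , q) ∷ es) xy = deleteEdge-⊆ G (deleteEdges-⊆ (deleteEdge G p q) es xy)

deleteEdges-keeps : ∀ {n} (G : Graph n) es {x y} → adj G x y ≡ true →
  All (λ e → ¬ SameEdge (x , y) e) es → adj (deleteEdges G es) x y ≡ true
deleteEdges-keeps G []             xy []           = xy
deleteEdges-keeps G ((p , q) ∷ es) xy (≁pq ∷ ≁es) =
  deleteEdges-keeps (deleteEdge G p q) es (deleteEdge-keeps G xy ≁pq) ≁es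

switch : ∀ {n} (G : Graph n) (a b c d : Fin n) → a ≢ c → b ≢ d → Graph n
switch G a b c d a≢c b≢d = addEdge (addEdge (deleteEdges G ((a , b) ∷ (c , d) ∷ [])) a c a≢c) b d b≢d

module _ {n} (G : Graph n) {a b c d : Fin n} (a≢c : a ≢ c) (b≢d : b ≢ d) where

  private
    G₂ = deleteEdges G ((a , b) ∷ (c , d) ∷ [])
    G₃ = addEdge G₂ a c a≢c

  switch-keeps : ∀ {x y} → adj G x y ≡ true → ¬ Same x y a b → ¬ Same x y c d →
    adj (switch G a b c d a≢c b≢d) x y ≡ true
  switch-keeps xy ≁ab ≁cd =
    addEdge-⊇ G₃ b≢d (addEdge-⊇ G₂ a≢c (deleteEdges-keeps G _ xy (≁ab ∷ ≁cd ∷ [])))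

  switch-adds-ac : adj (switch G a b c d a≢c b≢d) a c ≡ true
  switch-adds-ac = addEdge-⊇ G₃ b≢d (addEdge-adds G₂ a≢c (inj₁ (refl , refl)))

  switch-adds-bd : adj (switch G a b c d a≢c b≢d) b d ≡ true
  switch-adds-bd = addEdge-adds G₃ b≢d (inj₁ (refl , refl))

module _ {n} (G : Graph n) {a b c d : Fin n} (a≢c : a ≢ c) (b≢d : b ≢ d)
         (ab : adj G a b ≡ true) (cd : adj G c d ≡ true) (ac : adj G a c ≡ false) (bd : adj G b d ≡ false)
         (cd≁ab : ¬ Same c d a b) (bd≁ac : ¬ Same b d a c) where

  private
    G₁ = deleteEdge G a b
    G₂ = deleteEdge G₁ c d
    G₃ = addEdge G₂ a c a≢c

    rearrange : ∀ x a b c d → x + (a + c) + (b + d) ≡ x + (c + d) + (a + b)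
    rearrange = solve-∀

  deg-switch : ∀ i → deg (switch G a b c d a≢c b≢d) i ≡ deg G i
  deg-switch i = begin
    deg (switch G a b c d a≢c b≢d) i
      ≡⟨ deg-addEdge G₃ b≢d bd₃ i ⟩
    deg G₃ i + (δ i b + δ i d)
      ≡⟨ cong (_+ (δ i b + δ i d)) (deg-addEdge G₂ a≢c ac₂ i) ⟩
    deg G₂ i + (δ i a + δ i c) + (δ i b + δ i d)
      ≡⟨ rearrange (deg G₂ i) (δ i a) (δ i b) (δ i c) (δ i d) ⟩
    deg G₂ i + (δ i c + δ i d) + (δ i a + δ i b)
      ≡⟨ cong (_+ (δ i a + δ i b)) (deg-deleteEdge G₁ (deleteEdge-keeps G cd cd≁ab) i) ⟨
    deg G₁ i + (δ i a + δ i b)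
      ≡⟨ deg-deleteEdge G ab i ⟨
    deg G i ∎
    where
    open ≡-Reasoning
    ac₂ : adj G₂ a c ≡ false
    ac₂ = deleteEdge-absent G₁ (deleteEdge-absent G ac)
    bd₃ : adj G₃ b d ≡ false
    bd₃ = addEdge-absent G₂ a≢c (deleteEdge-absent G₁ (deleteEdge-absent G bd)) bd≁ac

  switch-realizes : ∀ {D} → Realizes G D → Realizes (switch G a b c d a≢c b≢d) D
  switch-realizes realizes i = trans (deg-switch i) (realizes i)

-- Walks

module _ {n} {G : Graph n} where

  _++ʷ_ : ∀ {i j k} → Walk G i j → Walk G j k → Walk G i k
  here     ++ʷ w = w
  step e v ++ʷ w = step e (v ++ʷ w)

  reverseʷ : ∀ {i j} → Walk G i j → Walk G j i
  reverseʷ here               = here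
  reverseʷ (step {i} {j} e w) = reverseʷ w ++ʷ step (trans (Graph.sym G j i) e) here

bridge : ∀ {n} {G H : Graph n} → (∀ x y → adj G x y ≡ true → Walk H x y) →
  ∀ {i j} → Walk G i j → Walk H i j
bridge f here               = here
bridge f (step {i} {j} e w) = f i j e ++ʷ bridge f w

walk-⊆ : ∀ {n} {G H : Graph n} → (∀ {x y} → adj G x y ≡ true → adj H x y ≡ true) →
  ∀ {i j} → Walk G i j → Walk H i j
walk-⊆ G⊆H = bridge (λ x y e → step (G⊆H e) here)

deleteEdge-connected : ∀ {n} {G : Graph n} {p q : Fin n} → Connected G →
  Walk (deleteEdge G p q) p q → Connected (deleteEdge G p q)
deleteEdge-connected {G = G} {p} {q} connected w i j = bridge bypass (connected i j)
  where
  bypass : ∀ x y → adj G x y ≡ true → Walk (deleteEdge G p q) x y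
  bypass x y xy with same? x y p q
  ... | yes (inj₁ (refl , refl)) = w
  ... | yes (inj₂ (refl , refl)) = reverseʷ w
  ... | no ¬S                    = step (deleteEdge-keeps G xy ¬S) here

walk-along : ∀ {n m} {G : Graph n} (v : Fin (suc m) → Fin n) (j l : Fin (suc m)) → toℕ j ≤ toℕ l →
  (∀ (i : Fin m) → toℕ j ≤ toℕ i → toℕ i < toℕ l → adj G (v (inject₁ i)) (v (suc i)) ≡ true) →
  Walk G (v j) (v l)
walk-along             v zero    zero    _         _     = here
walk-along {m = suc m} v zero    (suc l) _         steps =
  step (steps zero z≤n z<s) (walk-along (v ∘ suc) zero l z≤n (λ i _ i<l → steps (suc i) z≤n (s<s i<l)))
walk-along {m = suc m} v (suc j) (suc l) (s≤s j≤l) steps =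
  walk-along (v ∘ suc) j l j≤l (λ i j≤i i<l → steps (suc i) (s≤s j≤i) (s<s i<l))

-- Counting edges

IsEdge : ∀ {n} → Graph n → Fin n × Fin n → Set
IsEdge G (i , j) = toℕ i < toℕ j × adj G i j ≡ true

isEdgeᵇ : ∀ {n} → Graph n → Fin n → Fin n → Bool
isEdgeᵇ G i j = (toℕ i <ᵇ toℕ j) ∧ adj G i j

edges : ∀ {n} → Graph n → List (Fin n × Fin n)
edges {n} G = concatMap (λ i → map (i ,_) (filterᵇ (isEdgeᵇ G i) (allFin n))) (allFin n)

length-filterᵇ : ∀ {A : Set} (p : A → Bool) xs → length (filterᵇ p xs) ≡ sum (map (ind ∘ p) xs)
length-filterᵇ p [] = refl
length-filterᵇ p (x ∷ xs) with p x
... | true  = cong suc (length-filterᵇ p xs)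
... | false = length-filterᵇ p xs

length-concatMap : ∀ {A B : Set} (f : A → List B) xs → length (concatMap f xs) ≡ sum (map (length ∘ f) xs)
length-concatMap f [] = refl
length-concatMap f (x ∷ xs) = trans (length-++ (f x)) (cong (length (f x) +_) (length-concatMap f xs))

edgeCount≡length-edges : ∀ {n} (G : Graph n) → edgeCount G ≡ length (edges G)
edgeCount≡length-edges {n} G = sym (begin
  length (edges G)
    ≡⟨ length-concatMap (λ i → map (i ,_) (filterᵇ (isEdgeᵇ G i) (allFin n))) (allFin n) ⟩
  ∑ (λ i → length (map (i ,_) (filterᵇ (isEdgeᵇ G i) (allFin n))))
    ≡⟨ ∑-cong (λ i → length-map (i ,_) (filterᵇ (isEdgeᵇ G i) (allFin n))) ⟩
  ∑ (λ i → length (filterᵇ (isEdgeᵇ G i) (allFin n)))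
    ≡⟨ ∑-cong (λ i → length-filterᵇ (isEdgeᵇ G i) (allFin n)) ⟩
  edgeCount G ∎)
  where open ≡-Reasoning

∈-edges : ∀ {n} (G : Graph n) {e} → IsEdge G e → e ∈ edges G
∈-edges {n} G {i , j} (i<j , ij) = ∈-concatMap⁺ _ (lose (∈-allFin i)
  (∈-map⁺ (i ,_) (∈-filter⁺ (T? ∘ isEdgeᵇ G i) (∈-allFin j)
    (Equivalence.from T-∧ (<⇒<ᵇ i<j , Equivalence.from T-≡ ij)))))

∈-─ : ∀ {A : Set} {x y : A} {ys} (x∈ys : x ∈ ys) → y ∈ ys → y ≢ x → y ∈ ys ─ x∈ys
∈-─ (here refl) (here refl) y≢x = contradiction refl y≢x
∈-─ (here refl) (there y∈ys) _  = y∈ys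
∈-─ (there x∈ys) (here refl) _  = here refl
∈-─ (there x∈ys) (there y∈ys) y≢x = there (∈-─ x∈ys y∈ys y≢x)

unique⊆⇒length≤ : ∀ {A : Set} {xs ys : List A} → Unique xs → (∀ {x} → x ∈ xs → x ∈ ys) →
  length xs ≤ length ys
unique⊆⇒length≤ {xs = []} _ _ = z≤n
unique⊆⇒length≤ {xs = x ∷ xs} {ys} (x∉xs ∷ unique) xs⊆ys =
  subst (suc (length xs) ≤_) (sym (length-removeAt′ ys (index x∈ys)))
    (s≤s (unique⊆⇒length≤ unique
      (λ y∈xs → ∈-─ x∈ys (xs⊆ys (there y∈xs)) (≢-sym (All.lookup x∉xs y∈xs)))))
  where
  x∈ys = xs⊆ys (here refl)

HasEdges : ∀ {n} → Graph n → ℕ → Set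
HasEdges {n} G m = Σ (List (Fin n × Fin n)) λ es → Unique es × All (IsEdge G) es × m ≤ length es

HasEdges⇒≤edgeCount : ∀ {n} {G : Graph n} {m} → HasEdges G m → m ≤ edgeCount G
HasEdges⇒≤edgeCount {G = G} (es , unique , es⊆ , m≤) =
  ≤-trans m≤ (subst (length es ≤_) (sym (edgeCount≡length-edges G))
    (unique⊆⇒length≤ unique (λ e∈es → ∈-edges G (All.lookup es⊆ e∈es))))

orientEdge : ∀ {n} (G : Graph n) {p q : Fin n} → adj G p q ≡ true →
  Σ (Fin n × Fin n) λ e → IsEdge G e × Same (proj₁ e) (proj₂ e) p q
orientEdge G {p} {q} pq with <-cmp (toℕ p) (toℕ q)
... | tri< p<q _ _ = (p , q) , (p<q , pq) , inj₁ (refl , refl)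
... | tri≈ _ p≡q _ = contradiction (toℕ-injective p≡q) (adj⇒≢ G pq)
... | tri> _ _ q<p = (q , p) , (q<p , trans (Graph.sym G q p) pq) , inj₂ (refl , refl)

HasEdges-deleteEdge : ∀ {n} {G : Graph n} {p q m} → adj G p q ≡ true →
  HasEdges (deleteEdge G p q) m → HasEdges G (suc m)
HasEdges-deleteEdge {G = G} {p} {q} pq (es , unique , es⊆ , m≤) with orientEdge G pq
... | e , isEdge , e~pq = e ∷ es , All.map new es≁pq ∷ unique , isEdge ∷ All.map old es⊆ , s≤s m≤
  where
  es≁pq : All (λ f → ¬ Same (proj₁ f) (proj₂ f) p q) es
  es≁pq = All.map (λ f⊆ → deleteEdge-deleted G (proj₂ f⊆)) es⊆
  new : ∀ {f} → ¬ Same (proj₁ f) (proj₂ f) p q → e ≢ f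
  new f≁pq refl = f≁pq e~pq
  old : ∀ {f} → IsEdge (deleteEdge G p q) f → IsEdge G f
  old (f< , f⊆) = f< , deleteEdge-⊆ G f⊆

∉⇒All≢ : ∀ {A : Set} {x : A} {xs} → x ∉ xs → All (x ≢_) xs
∉⇒All≢ {xs = xs} = ¬Any⇒All¬ xs

_∈?_ : ∀ {n} (x : Fin n) (xs : List (Fin n)) → Dec (x ∈ xs)
x ∈? xs = any? (x ≟_) xs

∃∉ : ∀ {n} (vs : List (Fin n)) → Unique vs → length vs < n → ∃ λ v → v ∉ vs
∃∉ {n} vs unique |vs|<n with All.all? (_∈? vs) (allFin n)
... | yes all∈vs = contradiction
  (subst (_≤ length vs) (length-tabulate (λ i → i)) (unique⊆⇒length≤ (allFin⁺ n) (All.lookup all∈vs)))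
  (<⇒≱ |vs|<n)
... | no ¬all∈vs = satisfied (¬All⇒Any¬ (_∈? vs) (allFin n) ¬all∈vs)

crossingEdge : ∀ {n} {G : Graph n} (vs : List (Fin n)) {i j} → Walk G i j → i ∈ vs → j ∉ vs →
  ∃₂ λ x y → x ∈ vs × y ∉ vs × adj G x y ≡ true
crossingEdge vs here i∈vs j∉vs = contradiction i∈vs j∉vs
crossingEdge vs (step {i} {k} ik w) i∈vs j∉vs with k ∈? vs
... | yes k∈vs = crossingEdge vs w k∈vs j∉vs
... | no k∉vs  = i , k , i∈vs , k∉vs , ik

record Subtree {n} (G : Graph n) (r : Fin n) (k : ℕ) : Set where
  field
    vertices        : List (Fin n)
    treeEdges       : List (Fin n × Fin n)
    unique-vertices : Unique vertices
    unique-edges    : Unique treeEdges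
    length-vertices : length vertices ≡ suc k
    length-edges    : length treeEdges ≡ k
    areEdges        : All (IsEdge G) treeEdges
    endpoints       : All (λ e → proj₁ e ∈ vertices × proj₂ e ∈ vertices) treeEdges
    root            : r ∈ vertices

Same-∈ : ∀ {n} {a b x y : Fin n} {vs} → Same a b x y → x ∈ vs → a ∈ y ∷ vs × b ∈ y ∷ vs
Same-∈ (inj₁ (refl , refl)) x∈vs = there x∈vs , here refl
Same-∈ (inj₂ (refl , refl)) x∈vs = here refl , there x∈vs

Same-∉ : ∀ {n} {a b x y : Fin n} {vs} → Same a b x y → y ∉ vs → ¬ (a ∈ vs × b ∈ vs)
Same-∉ (inj₁ (_ , refl)) y∉vs (_ , b∈vs) = y∉vs b∈vs
Same-∉ (inj₂ (refl , _)) y∉vs (a∈vs , _) = y∉vs a∈vs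

extend : ∀ {n} {G : Graph n} {r k} (T : Subtree G r k) → let open Subtree T in
  ∀ {x y} → x ∈ vertices → y ∉ vertices → adj G x y ≡ true → Subtree G r (suc k)
extend {G = G} T {x} {y} x∈ y∉ xy with orientEdge G xy
... | e , isEdge , e~xy = record
  { vertices        = y ∷ vertices
  ; treeEdges       = e ∷ treeEdges
  ; unique-vertices = ∉⇒All≢ y∉ ∷ unique-vertices
  ; unique-edges    = All.map (λ ends → λ { refl → Same-∉ e~xy y∉ ends }) endpoints ∷ unique-edges
  ; length-vertices = cong suc length-vertices
  ; length-edges    = cong suc length-edges
  ; areEdges        = isEdge ∷ areEdges
  ; endpoints       = Same-∈ e~xy x∈ ∷ All.map (λ (a∈ , b∈) → there a∈ , there b∈) endpoints
  ; root            = there root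
  }
  where open Subtree T

grow : ∀ {n} {G : Graph n} → Connected G → (r : Fin n) → ∀ k → suc k ≤ n → Subtree G r k
grow connected r zero _ = record
  { vertices = r ∷ [] ; treeEdges = [] ; unique-vertices = [] ∷ [] ; unique-edges = []
  ; length-vertices = refl ; length-edges = refl ; areEdges = [] ; endpoints = [] ; root = here refl }
grow {n} connected r (suc k) k<n
  with T ← grow connected r k (<⇒≤ k<n)
  with v , v∉ ← ∃∉ (Subtree.vertices T) (Subtree.unique-vertices T)
                    (subst (_< n) (sym (Subtree.length-vertices T)) k<n)
  with x , y , x∈ , y∉ , xy ← crossingEdge (Subtree.vertices T) (connected r v) (Subtree.root T) v∉
  = extend T x∈ y∉ xy

connected⇒HasEdges : ∀ {n} {G : Graph n} → Connected G → HasEdges G (pred n)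
connected⇒HasEdges {zero} _ = [] , [] , [] , z≤n
connected⇒HasEdges {suc m} connected = treeEdges , unique-edges , areEdges , ≤-reflexive (sym length-edges)
  where open Subtree (grow connected zero m ≤-refl)

-- Each deleted edge whose endpoints stay joined in the final graph adds one to the
-- n - 1 edges of a spanning tree.
HasEdges-deleteEdges : ∀ {n} {G : Graph n} es → Connected G →
  AllPairs (λ e f → ¬ SameEdge e f) es →
  All (λ (p , q) → adj G p q ≡ true) es →
  All (λ (p , q) → Walk (deleteEdges G es) p q) es →
  HasEdges G (length es + pred n)
HasEdges-deleteEdges [] connected _ _ _ = connected⇒HasEdges connected
HasEdges-deleteEdges {G = G} ((p , q) ∷ es) connected (pq≁es ∷ distinct) (pq ∷ es⊆G) (w ∷ ws) =
  HasEdges-deleteEdge {G = G} pq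
    (HasEdges-deleteEdges es connected′ distinct (All.zipWith kept (pq≁es , es⊆G)) ws)
  where
  connected′ : Connected (deleteEdge G p q)
  connected′ = deleteEdge-connected connected (walk-⊆ (deleteEdges-⊆ (deleteEdge G p q) es) w)
  kept : ∀ {f} → ¬ SameEdge (p , q) f × adj G (proj₁ f) (proj₂ f) ≡ true →
    adj (deleteEdge G p q) (proj₁ f) (proj₂ f) ≡ true
  kept (pq≁f , f⊆G) = deleteEdge-keeps G f⊆G (pq≁f ∘ Same-comm)

n+1<3+pred[n] : ∀ n → n + 1 < 3 + pred n
n+1<3+pred[n] zero    = s≤s (s≤s z≤n)
n+1<3+pred[n] (suc m) = s≤s (s≤s (≤-reflexive (+-comm m 1)))

bicyclic⇒¬HasEdges : ∀ {n} {G : Graph n} → edgeCount G ≡ n + 1 → ¬ HasEdges G (3 + pred n)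
bicyclic⇒¬HasEdges {n} {G} edgeCount≡ has =
  <⇒≱ (n+1<3+pred[n] n) (subst (_ ≤_) edgeCount≡ (HasEdges⇒≤edgeCount {G = G} has))

-- The bowtie B(3, 6 + k)

Same-step : ∀ {m} {i : Fin m} {p q : Fin (suc m)} → Same (inject₁ i) (suc i) p q →
  (toℕ p ≡ toℕ i × toℕ q ≡ suc (toℕ i)) ⊎ (toℕ q ≡ toℕ i × toℕ p ≡ suc (toℕ i))
Same-step {i = i} (inj₁ (refl , refl)) = inj₁ (toℕ-inject₁ i , refl)
Same-step {i = i} (inj₂ (refl , refl)) = inj₂ (toℕ-inject₁ i , refl)

step-≁-nonconsecutive : ∀ {m} (i : Fin m) {p q : Fin (suc m)} →
  suc (toℕ p) ≢ toℕ q → suc (toℕ q) ≢ toℕ p → ¬ Same (inject₁ i) (suc i) p q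
step-≁-nonconsecutive i p≁q q≁p S with Same-step S
... | inj₁ (p≡i , q≡1+i) = p≁q (trans (cong suc p≡i) (sym q≡1+i))
... | inj₂ (q≡i , p≡1+i) = q≁p (trans (cong suc q≡i) (sym p≡1+i))

step-≁-below : ∀ {m} (i : Fin m) {p q : Fin (suc m)} {b} → b ≤ toℕ i → toℕ q < b →
  ¬ Same (inject₁ i) (suc i) p q
step-≁-below i b≤i q<b S with Same-step S
... | inj₁ (_ , q≡1+i) = <⇒≱ q<b (≤-trans b≤i (subst (toℕ i ≤_) (sym q≡1+i) (n≤1+n (toℕ i))))
... | inj₂ (q≡i , _)   = <⇒≱ q<b (subst (_ ≤_) (sym q≡i) b≤i)

module LongBowtie {n k} (G : Graph n) (t : Fin 3 → Fin n) (u : Fin (6 + k) → Fin n)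
  (t-cycle : IsCycle G 3 t) (u-cycle : IsCycle G (6 + k) u)
  {a b} (meets-only : ∀ i j → t i ≡ u j → i ≡ a × j ≡ b) where

  meet : ∀ {x y p q} → t x ≡ u p → t y ≡ u q → x ≡ y
  meet tx≡up ty≡uq = trans (proj₁ (meets-only _ _ tx≡up)) (sym (proj₁ (meets-only _ _ ty≡uq)))

  last : Fin (6 + k)
  last = fromℕ (5 + k)

  t-injective : ∀ {x y} → t x ≡ t y → x ≡ y
  t-injective = proj₁ (proj₂ t-cycle)

  u-injective : ∀ {i j} → u i ≡ u j → i ≡ j
  u-injective = proj₁ (proj₂ u-cycle)

  t₀t₁ : adj G (t 0F) (t 1F) ≡ true
  t₀t₁ = proj₂ (proj₂ t-cycle) 0F 1F (inj₁ refl)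

  t₀t₂ : adj G (t 0F) (t 2F) ≡ true
  t₀t₂ = trans (Graph.sym G _ _) (proj₂ (proj₂ t-cycle) 2F 0F (inj₂ (refl , refl)))

  t₂t₁ : adj G (t 2F) (t 1F) ≡ true
  t₂t₁ = trans (Graph.sym G _ _) (proj₂ (proj₂ t-cycle) 1F 2F (inj₁ refl))

  u-step : ∀ i → adj G (u (inject₁ i)) (u (suc i)) ≡ true
  u-step i = proj₂ (proj₂ u-cycle) (inject₁ i) (suc i) (inj₁ (cong suc (toℕ-inject₁ i)))

  u-wrap : adj G (u 0F) (u last) ≡ true
  u-wrap = trans (Graph.sym G _ _) (proj₂ (proj₂ u-cycle) last 0F (inj₂ (cong suc (toℕ-fromℕ (5 + k)) , refl)))

  t≁u : ∀ {x y p q} → x ≢ y → ¬ Same (t x) (t y) (u p) (u q)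
  t≁u x≢y (inj₁ (tx≡up , ty≡uq)) = x≢y (meet tx≡up ty≡uq)
  t≁u x≢y (inj₂ (tx≡uq , ty≡up)) = x≢y (meet tx≡uq ty≡up)

  u≁t₀₁ : ∀ {p q} → ¬ Same (u p) (u q) (t 0F) (t 1F)
  u≁t₀₁ = t≁u (λ ()) ∘ Same-comm

  t≁t : ∀ x y p q → {False (same? x y p q)} → ¬ Same (t x) (t y) (t p) (t q)
  t≁t x y p q {xy≁pq} = distinct x y p q {xy≁pq} ∘ Same-injective t-injective

  u≁u : ∀ i j p q → {False (same? i j p q)} → ¬ Same (u i) (u j) (u p) (u q)
  u≁u i j p q {ij≁pq} = distinct i j p q {ij≁pq} ∘ Same-injective u-injective

  u≢u : ∀ i j → {False (i ≟ j)} → u i ≢ u j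
  u≢u i j {i≢j} = toWitnessFalse i≢j ∘ u-injective

  u-step≁ : ∀ i {p q} → suc (toℕ p) ≢ toℕ q → suc (toℕ q) ≢ toℕ p →
    ¬ Same (u (inject₁ i)) (u (suc i)) (u p) (u q)
  u-step≁ i p≁q q≁p = step-≁-nonconsecutive i p≁q q≁p ∘ Same-injective u-injective

  Cut : Graph n → (p q p′ q′ : Fin (6 + k)) → Graph n
  Cut X p q p′ q′ = deleteEdges X ((t 0F , t 1F) ∷ (u p , u q) ∷ (u p′ , u q′) ∷ [])

  cut-keeps : ∀ (X : Graph n) {p q p′ q′ x y} → adj X x y ≡ true → ¬ Same x y (t 0F) (t 1F) →
    ¬ Same x y (u p) (u q) → ¬ Same x y (u p′) (u q′) → adj (Cut X p q p′ q′) x y ≡ true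
  cut-keeps X xy ≁t₀t₁ ≁pq ≁p′q′ = deleteEdges-keeps X _ xy (≁t₀t₁ ∷ ≁pq ∷ ≁p′q′ ∷ [])

  three-cycles : ∀ (X : Graph n) {p q p′ q′} → Connected X →
    adj X (t 0F) (t 1F) ≡ true → adj X (t 0F) (t 2F) ≡ true → adj X (t 2F) (t 1F) ≡ true →
    adj X (u p) (u q) ≡ true → adj X (u p′) (u q′) ≡ true → ¬ Same p q p′ q′ →
    Walk (Cut X p q p′ q′) (u p) (u q) → Walk (Cut X p q p′ q′) (u p′) (u q′) →
    HasEdges X (3 + pred n)
  three-cycles X connected t₀t₁ˣ t₀t₂ˣ t₂t₁ˣ pq p′q′ pq≁p′q′ w w′ =
    HasEdges-deleteEdges _ connected
      ((t≁u (λ ()) ∷ t≁u (λ ()) ∷ []) ∷ (pq≁p′q′ ∘ Same-injective u-injective ∷ []) ∷ [] ∷ [])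
      (t₀t₁ˣ ∷ pq ∷ p′q′ ∷ [])
      (triangle-walk ∷ w ∷ w′ ∷ [])
    where
    triangle-walk = step (cut-keeps X t₀t₂ˣ (t≁t 0F 2F 0F 1F) (t≁u (λ ())) (t≁u (λ ())))
                   (step (cut-keeps X t₂t₁ˣ (t≁t 2F 1F 0F 1F) (t≁u (λ ())) (t≁u (λ ()))) here)

  chord-cycles : ∀ {p q} → Connected G → adj G (u p) (u q) ≡ true → toℕ p ≤ toℕ q →
    suc (toℕ p) ≢ toℕ q → suc (toℕ q) ≢ toℕ p → ¬ Same p q 0F last → HasEdges G (3 + pred n)
  chord-cycles {p} {q} connected pq p≤q p≁q q≁p pq≁wrap =
    three-cycles G connected t₀t₁ t₀t₂ t₂t₁ pq u-wrap pq≁wrap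
      (walk-along u p q p≤q (λ i _ _ → survives i))
      (walk-along u 0F last z≤n (λ i _ _ → survives i))
    where
    survives : ∀ i → adj (Cut G p q 0F last) (u (inject₁ i)) (u (suc i)) ≡ true
    survives i = cut-keeps G (u-step i) u≁t₀₁ (u-step≁ i p≁q q≁p) (u-step≁ i (λ ()) (λ ()))

  Sw : Graph n
  Sw = switch G (u 1F) (u 2F) (u 5F) (u 4F) (u≢u 1F 5F) (u≢u 2F 4F)

  Sw-realizes : ∀ {D} → adj G (u 1F) (u 5F) ≡ false → adj G (u 2F) (u 4F) ≡ false →
    Realizes G D → Realizes Sw D
  Sw-realizes {D} u₁u₅ u₂u₄ = switch-realizes G (u≢u 1F 5F) (u≢u 2F 4F)
    (u-step 1F) (trans (Graph.sym G _ _) (u-step 4F)) u₁u₅ u₂u₄ (u≁u 5F 4F 1F 2F) (u≁u 2F 4F 1F 5F) {D}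

  Sw-keeps : ∀ {x y} → adj G x y ≡ true → ¬ Same x y (u 1F) (u 2F) → ¬ Same x y (u 5F) (u 4F) →
    adj Sw x y ≡ true
  Sw-keeps = switch-keeps G (u≢u 1F 5F) (u≢u 2F 4F)

  switched-cycles : Connected Sw → HasEdges Sw (3 + pred n)
  switched-cycles connected =
    three-cycles Sw connected
      (Sw-keeps t₀t₁ (t≁u (λ ())) (t≁u (λ ())))
      (Sw-keeps t₀t₂ (t≁u (λ ())) (t≁u (λ ())))
      (Sw-keeps t₂t₁ (t≁u (λ ())) (t≁u (λ ())))
      (switch-adds-bd G (u≢u 1F 5F) (u≢u 2F 4F))
      (Sw-keeps u-wrap (u≁u 0F last 1F 2F) (u≁u 0F last 5F 4F))
      (distinct 2F 4F 0F last)
      (step (survives 2F (distinct 2F 3F 1F 2F) (distinct 2F 3F 5F 4F))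
      (step (survives 3F (distinct 3F 4F 1F 2F) (distinct 3F 4F 5F 4F)) here))
      (step (survives 0F (distinct 0F 1F 1F 2F) (distinct 0F 1F 5F 4F))
      (step u₁u₅
      (walk-along u 5F last (s≤s (s≤s (s≤s (s≤s (s≤s z≤n)))))
        (λ i 5≤i _ → survives i (step-≁-below i 5≤i (s≤s (s≤s (s≤s z≤n))))
                                (step-≁-below i 5≤i (s≤s (s≤s (s≤s (s≤s (s≤s z≤n))))))))))
    where
    H = Cut Sw 2F 4F 0F last
    survives : ∀ i → ¬ Same (inject₁ i) (suc i) 1F 2F → ¬ Same (inject₁ i) (suc i) 5F 4F →
      adj H (u (inject₁ i)) (u (suc i)) ≡ true
    survives i ≁12 ≁54 = cut-keeps Sw
      (Sw-keeps (u-step i) (≁12 ∘ Same-injective u-injective) (≁54 ∘ Same-injective u-injective))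
      u≁t₀₁ (u-step≁ i (λ ()) (λ ())) (u-step≁ i (λ ()) (λ ()))
    u₁u₅ : adj H (u 1F) (u 5F) ≡ true
    u₁u₅ = cut-keeps Sw (switch-adds-ac G (u≢u 1F 5F) (u≢u 2F 4F))
      u≁t₀₁ (u≁u 1F 5F 2F 4F) (u≁u 1F 5F 0F last)

  excess-realization : ∀ {D} → Realizes G D →
    Σ (Graph n) λ X → Realizes X D × (Connected X → HasEdges X (3 + pred n))
  excess-realization {D} realizes with adj G (u 2F) (u 4F) in u₂u₄ | adj G (u 1F) (u 5F) in u₁u₅
  ... | true  | _     = G , realizes ,
    λ connected → chord-cycles connected u₂u₄ (s≤s (s≤s z≤n)) (λ ()) (λ ()) (distinct 2F 4F 0F last)
  ... | false | true  = G , realizes ,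
    λ connected → chord-cycles connected u₁u₅ (s≤s z≤n) (λ ()) (λ ()) (distinct 1F 5F 0F last)
  ... | false | false = Sw , Sw-realizes {D} u₁u₅ u₂u₄ realizes , switched-cycles

no-long-bowtie : ∀ {n} {D : Vec ℕ n} → ForciblyBicyclic D → (G : Graph n) → Realizes G D →
  ∀ k → ¬ ContainsBowtie G 3 (6 + k)
no-long-bowtie {D = D} (_ , forced) G realizes k (t , u , t-cycle , u-cycle , _ , _ , _ , meets-only)
  with X , realizesX , cycles ← LongBowtie.excess-realization G t u t-cycle u-cycle meets-only {D} realizes
  with connected , edgeCount≡ ← forced X realizesX
  = bicyclic⇒¬HasEdges {G = X} edgeCount≡ (cycles connected)

lemma4p5 : ∀ {n : ℕ} (D : Vec ℕ n) → ForciblyBicyclic D → (G : Graph n) → Realizes G D → (s : ℕ) → ContainsBowtie G 3 s → 3 ≤ s × s ≤ 5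
lemma4p5 D bicyclic G realizes s bowtie@(_ , _ , _ , (3≤s , _) , _) = 3≤s , s≤5
  where
  s≤5 : s ≤ 5
  s≤5 with s ≤? 5
  ... | yes s≤5 = s≤5
  ... | no  s≰5 = contradiction (subst (ContainsBowtie G 3) (sym (m+[n∸m]≡n (≰⇒> s≰5))) bowtie)
                                (no-long-bowtie {D = D} bicyclic G realizes (s ∸ 6))
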